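{- Let $\Sigma$ be an effect signature, $Q$ a complete lattice, and $\mathcal{Q}$ a set of modalities on $Q$ (each $q\in\mathcal{Q}$ a function $[\![q]\!]:T Q\to Q$). Suppose every $q\in\mathcal{Q}$ is leaf-monotone. Then for any two double trees $r,r'\in TTQ$: $$r \trianglelefteq r' \iff \forall F: TQ\to Q,\ \forall q\in\mathcal{Q},\ \ (r\in q(F)) \le (r'\in q({\preceq}{\upharpoonright}F)).$$
   Context: Effect signature: a set $\Sigma$ of operation symbols, each with an arity of one of the forms $\alpha^n\to\alpha$ ($n\in\mathbb{N}$), $\mathbb{N}\times\alpha^n\to\alpha$, or $\alpha^{\mathbb{N}}\to\alpha$. For a set $X$, $TX$ is the set of effect trees over $X$: labelled, possibly infinite-depth trees whose nodes are either a leaf labelled $\bot$, a leaf labelled by some $x\in X$, a node labelled $\sigma$ with children $t_1,\dots,t_n$ (for $\sigma:\alpha^n\to\alpha$), a node labelled $\sigma$ with children $t_0,t_1,\dots$ (for $\sigma:\alpha^{\mathbb{N}}\to\alpha$), or a node labelled $\sigma_m$ ($m\in\mathbb{N}$) with children $t_1,\dots,t_n$ (for $\sigma:\mathbb{N}\times\alpha^n\to\alpha$). For $h:X\to Y$, $h^*:TX\to TY$ replaces every non-$\bot$ leaf $x$ by $h(x)$. $\mu:TTX\to TX$ flattens a tree of trees by grafting each leaf tree in place of its leaf. $Q$ is a complete lattice with order $\le$. A modality $q$ is a function $[\![q]\!]:TQ\to Q$; for $h:X\to Q$ and $t\in TX$ write $(t\in q(h)) := [\![q]\!](h^*(t))$.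 The leaf order on $TQ$: $t\,T(\le)\,r$ iff $r$ is obtained from $t$ by replacing each leaf labelled $a\in Q$ by a leaf labelled some $b\in Q$ with $a\le b$ ($\bot$ leaves and internal nodes unchanged). $q$ is leaf-monotone if $t\,T(\le)\,r$ implies $[\![q]\!](t)\le[\![q]\!](r)$. For a relation $R\subseteq X\times Y$ and $h:X\to Q$, define $(R{\upharpoonright}h):Y\to Q$ by $(R{\upharpoonright}h)(y)=\sup\{h(x)\mid x\in X,\ xRy\}$. Preorder $\preceq$ on $TQ$: $t\preceq t'$ iff for all $q\in\mathcal{Q}$ and all monotone $h:Q\to Q$, $(t\in q(h))\le(t'\in q(h))$. A function $H:TQ\to Q$ is quantitatively behaviourally saturated ($H\in\mathrm{QBS}$) if $t\preceq t'$ implies $H(t)\le H(t')$. Preorder $\trianglelefteq$ on $TTQ$: $r\trianglelefteq r'$ iff for all $q\in\mathcal{Q}$ and all $H\in\mathrm{QBS}$, $(r\in q(H))\le(r'\in q(H))$. -}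

module Defs where

open import Level using (0ℓ)
open import Data.Nat using (ℕ; _<_)
open import Data.Unit using (⊤)
open import Data.Empty using (⊥)
open import Data.List using (List; []; _∷_; _++_; [_])
open import Data.Product using (Σ; _×_; _,_; proj₁; proj₂)
open import Relation.Nullary using (¬_)
open import Relation.Binary.PropositionalEquality using (_≡_; refl; cong)
open import Relation.Binary.Structures using (IsPartialOrder)

-- The three admissible arity shapes of an operation symbol:
--   fin n : α^n → α,   par n : ℕ × α^n → α,   inf : α^ℕ → α
data Arity : Set where
  fin : ℕ → Arity
  par : ℕ → Arity
  inf : Arity

Param : Arity → Set
Param (fin n) = ⊤
Param (par n) = ℕ
Param inf     = ⊤

-- child positions, encoded as natural numbers: i is a valid child
-- position iff  i < n  (children t_1..t_n are at positions 0..n-1),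
-- resp. any i for an α^ℕ → α operation
ValidPos : Arity → ℕ → Set
ValidPos (fin n) i = i < n
ValidPos (par n) i = i < n
ValidPos inf     i = ⊤

record Signature : Set₁ where
  field
    Op    : Set
    arity : Op → Arity
open Signature public

-- Effect trees (possibly infinite depth), represented by their node
-- labelling on paths.  A path is a list of child positions read from
-- the root.  The labelling is canonical: a path that leaves the tree
-- is labelled bot (so every effect tree has exactly one labelling).

module _ (S : Signature) where

  data Label (X : Set) : Set where
    bot  : Label X
    leaf : X → Label X
    op   : (σ : Op S) → Param (arity S σ) → Label X

  Valid : {X : Set} → Label X → ℕ → Set
  Valid bot        i = ⊥
  Valid (leaf x)   i = ⊥
  Valid (op σ p)   i = ValidPos (arity S σ) i

  Path : Set
  Path = List ℕ

  record T (X : Set) : Set where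
    constructor mkT
    field
      lab   : Path → Label X
      canon : ∀ ps i → ¬ Valid (lab ps) i → lab (ps ++ [ i ]) ≡ bot
  open T public

  mapLabel : {X Y : Set} → (X → Y) → Label X → Label Y
  mapLabel h bot      = bot
  mapLabel h (leaf x) = leaf (h x)
  mapLabel h (op σ p) = op σ p

  _* : {X Y : Set} → (X → Y) → T X → T Y
  lab   ((h *) t) ps = mapLabel h (lab t ps)
  canon ((h *) t) ps i nv =
    cong (mapLabel h) (canon t ps i (λ v → nv (valid-map' (lab t ps) v)))
    where
      valid-map' : (l : _) → Valid l i → Valid (mapLabel h l) i
      valid-map' (op σ p) v = v

  data LabelRel {A B : Set} (R : A → B → Set) : Label A → Label B → Set where
    bot  : LabelRel R bot bot
    leaf : ∀ {a b} → R a b → LabelRel R (leaf a) (leaf b)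
    op   : ∀ σ p → LabelRel R (op σ p) (op σ p)

  TRel : {A B : Set} (R : A → B → Set) → T A → T B → Set
  TRel R t r = ∀ ps → LabelRel R (lab t ps) (lab r ps)

record CompleteLattice : Set₁ where
  field
    Carrier        : Set
    _≤_            : Carrier → Carrier → Set
    isPartialOrder : IsPartialOrder _≡_ _≤_
    ⨆              : {I : Set} → (I → Carrier) → Carrier
    ⨆-upper        : {I : Set} (f : I → Carrier) (i : I) → f i ≤ ⨆ f
    ⨆-least        : {I : Set} (f : I → Carrier) (u : Carrier) →
                     (∀ i → f i ≤ u) → ⨆ f ≤ u
open CompleteLattice public

module Theory (S : Signature) (L : CompleteLattice)
              (Mod : Set) (⟦_⟧ : Mod → T S (Carrier L) → Carrier L) where

  Q : Set
  Q = Carrier L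

  _≤Q_ : Q → Q → Set
  _≤Q_ = _≤_ L

  _∈_⟨_⟩ : {X : Set} → T S X → Mod → (X → Q) → Q
  t ∈ q ⟨ h ⟩ = ⟦ q ⟧ ((_* S h) t)

  LeafMonotone : Mod → Set
  LeafMonotone q = ∀ t r → TRel S _≤Q_ t r → ⟦ q ⟧ t ≤Q ⟦ q ⟧ r

  _↾_ : {X Y : Set} → (X → Y → Set) → (X → Q) → Y → Q
  (R ↾ h) y = ⨆ L {Σ _ (λ x → R x y)} (λ xr → h (proj₁ xr))

  Monotone : (Q → Q) → Set
  Monotone h = ∀ {a b} → a ≤Q b → h a ≤Q h b

  _≼_ : T S Q → T S Q → Set
  t ≼ t' = ∀ (q : Mod) (h : Q → Q) → Monotone h → (t ∈ q ⟨ h ⟩) ≤Q (t' ∈ q ⟨ h ⟩)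

  QBS : (T S Q → Q) → Set
  QBS H = ∀ t t' → t ≼ t' → H t ≤Q H t'

  _⊴_ : T S (T S Q) → T S (T S Q) → Set
  r ⊴ r' = ∀ (q : Mod) (H : T S Q → Q) → QBS H → (r ∈ q ⟨ H ⟩) ≤Q (r' ∈ q ⟨ H ⟩)

module Submission where

open import Defs
open import Function.Bundles using (_⇔_; mk⇔)
open import Data.Product using (_,_)
open import Relation.Binary.Core using (_Preserves_⟶_)
open import Relation.Binary.Structures using (IsPartialOrder)

-- Both directions compare r and r' through the leaf-monotone modalities, with the leaf
-- valuation changed pointwise: F ≤ (≼ ↾ F) because ≼ is reflexive, (≼ ↾ F) is QBS because
-- ≼ is transitive, and (≼ ↾ H) ≤ H whenever H is QBS.  So (≼ ↾ F) is the least QBS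
-- function above F, and quantifying over all F is the same as quantifying over QBS H.

module Saturation (S : Signature) (L : CompleteLattice) (Mod : Set)
                  (⟦_⟧ : Mod → T S (Carrier L) → Carrier L) where
  open Theory S L Mod ⟦_⟧
  open IsPartialOrder (isPartialOrder L) using () renaming (refl to ≤-refl; trans to ≤-trans)

  *-mono-≤ : {X : Set} {h k : X → Q} → (∀ x → h x ≤Q k x) →
             ∀ t → TRel S _≤Q_ ((_* S h) t) ((_* S k) t)
  *-mono-≤ h≤k t ps with lab t ps
  ... | bot    = bot
  ... | leaf x = leaf (h≤k x)
  ... | op σ p = op σ p

  ∈-mono : ∀ {q} → LeafMonotone q → {X : Set} {h k : X → Q} →
           (∀ x → h x ≤Q k x) → ∀ t → (t ∈ q ⟨ h ⟩) ≤Q (t ∈ q ⟨ k ⟩)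
  ∈-mono mono h≤k t = mono _ _ (*-mono-≤ h≤k t)

  module _ {X : Set} {R : X → X → Set} where

    ↾-inflationary : (∀ x → R x x) → (F : X → Q) → ∀ x → F x ≤Q (R ↾ F) x
    ↾-inflationary refl F x = ⨆-upper L _ (x , refl x)

    ↾-preserves : (∀ x y z → R x y → R y z → R x z) → (F : X → Q) → (R ↾ F) Preserves R ⟶ _≤Q_
    ↾-preserves trans F yRy′ =
      ⨆-least L _ _ (λ { (x , xRy) → ⨆-upper L _ (x , trans _ _ _ xRy yRy′) })

    ↾-deflationary : {H : X → Q} → H Preserves R ⟶ _≤Q_ → ∀ y → (R ↾ H) y ≤Q H y
    ↾-deflationary H-pres y = ⨆-least L _ _ (λ { (x , xRy) → H-pres xRy })

  ≼-refl : ∀ t → t ≼ t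
  ≼-refl t q h _ = ≤-refl {t ∈ q ⟨ h ⟩}

  ≼-trans : ∀ t t′ t″ → t ≼ t′ → t′ ≼ t″ → t ≼ t″
  ≼-trans _ _ _ t≼t′ t′≼t″ q h h-mono = ≤-trans (t≼t′ q h h-mono) (t′≼t″ q h h-mono)

  ≼↾-QBS : (F : T S Q → Q) → QBS (_≼_ ↾ F)
  ≼↾-QBS F t t′ = ↾-preserves ≼-trans F {t} {t′}

lemma10 : (S : Signature) (L : CompleteLattice) (Mod : Set)
          (⟦_⟧ : Mod → T S (Carrier L) → Carrier L) →
          (∀ q → Theory.LeafMonotone S L Mod ⟦_⟧ q) →
          (r r' : T S (T S (Carrier L))) →
          Theory._⊴_ S L Mod ⟦_⟧ r r'
            ⇔ (∀ (F : T S (Carrier L) → Carrier L) (q : Mod) →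
                 _≤_ L (Theory._∈_⟨_⟩ S L Mod ⟦_⟧ r q F)
                       (Theory._∈_⟨_⟩ S L Mod ⟦_⟧ r' q
                          (Theory._↾_ S L Mod ⟦_⟧ (Theory._≼_ S L Mod ⟦_⟧) F)))
lemma10 S L Mod ⟦_⟧ mono r r′ = mk⇔ to from
  where
  open Theory S L Mod ⟦_⟧
  open Saturation S L Mod ⟦_⟧
  open IsPartialOrder (isPartialOrder L) using () renaming (trans to ≤-trans)

  to : r ⊴ r′ → ∀ F q → (r ∈ q ⟨ F ⟩) ≤Q (r′ ∈ q ⟨ _≼_ ↾ F ⟩)
  to r⊴r′ F q = ≤-trans (∈-mono (mono q) (↾-inflationary ≼-refl F) r)
                        (r⊴r′ q (_≼_ ↾ F) (≼↾-QBS F))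

  from : (∀ F q → (r ∈ q ⟨ F ⟩) ≤Q (r′ ∈ q ⟨ _≼_ ↾ F ⟩)) → r ⊴ r′
  from r≤r′ q H H-QBS = ≤-trans (r≤r′ H q)
    (∈-mono (mono q) (↾-deflationary (H-QBS _ _)) r′)
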